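{- Let $G$ be a $2$-connected simple graph and let $\{u,v\}$ be a $2$-vertex cut of $G$. If $G$ has a Tutte tree, then exactly one of the following holds: (i) there are exactly two $\{u,v\}$-bridges in $G$ and at least one of them has a Hamiltonian $uv$-path; or (ii) there are exactly three $\{u,v\}$-bridges in $G$, one of which is trivial and another of which has a Hamiltonian $uv$-path.
   Context: For a proper subgraph $H$ of a connected graph $G$, an $H$-bridge is either an edge of $E(G)\setminus E(H)$ with both ends in $V(H)$, or a component $C$ of $G-H$ together with all edges joining $C$ to $H$; a $\{u,v\}$-bridge is an $H$-bridge where $H$ consists of the two vertices $u,v$ only. A bridge is trivial if it is a single edge (has no vertex outside $H$). A Hamiltonian $uv$-path in a $\{u,v\}$-bridge $B$ is a $uv$-path in $B$ containing all vertices of $B$. For a subgraph $H$, $G-H$ is the subgraph induced by $V(G)\setminus V(H)$. A path $P$ is nonseparating if $G-P$ is connected (the null and one-vertex graphs count as connected). A Tutte tree of $G$ is a spanning tree $T$ such that every path contained in $T$ is nonseparating in $G$. -}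

module Defs where

open import Data.Nat using (ℕ; _≤_; suc; _+_)
open import Data.Fin using (Fin)
open import Data.Fin.Subset using (Subset; _∈_; _∉_)
open import Data.Bool using (Bool; true; false)
open import Data.List using (List; []; _∷_; length; head; last)
open import Data.List.Relation.Unary.Linked using (Linked)
open import Data.List.Relation.Unary.All using (All)
import Data.List.Relation.Unary.Unique.Propositional as UniqueP
import Data.List.Membership.Propositional as LM
open import Data.Maybe using (just)
open import Data.Product using (_×_; Σ; ∃; ∃-syntax; _,_)
open import Data.Sum using (_⊎_)
open import Relation.Binary.PropositionalEquality using (_≡_; _≢_)
open import Relation.Nullary using (¬_)
open import Data.Empty using (⊥)
open import Data.Unit using (⊤)

record Graph (n : ℕ) : Set where
  field
    adj    : Fin n → Fin n → Bool
    sym    : ∀ x y → adj x y ≡ adj y x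
    irrefl : ∀ x → adj x x ≡ false

  Adj : Fin n → Fin n → Set
  Adj x y = adj x y ≡ true

open Graph public

module _ {n : ℕ} where

  Rel : Set₁
  Rel = Fin n → Fin n → Set

  VSet : Set₁
  VSet = Fin n → Set

  AllV : VSet
  AllV _ = ⊤

  data Walk (E : Rel) (S : VSet) : Fin n → Fin n → Set where
    stay : ∀ {x} → S x → Walk E S x x
    step : ∀ {x y z} → S x → E x y → Walk E S y z → Walk E S x z

  -- The subgraph with vertex set S and edges E (restricted to S) is connected.
  -- (The null graph and one-vertex graphs are connected.)
  Connected : Rel → VSet → Set
  Connected E S = ∀ x y → S x → S y → Walk E S x y

  IsPath : Rel → List (Fin n) → Set
  IsPath E P = UniqueP.Unique P × Linked E P × P ≢ []

  IsCycle : Rel → List (Fin n) → Set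
  IsCycle E [] = ⊥
  IsCycle E (x ∷ xs) =
    UniqueP.Unique (x ∷ xs) × Linked E (x ∷ xs) × 3 ≤ length (x ∷ xs)
    × E (lastV x xs) x
    where
      lastV : Fin n → List (Fin n) → Fin n
      lastV y [] = y
      lastV y (z ∷ zs) = lastV z zs

  Acyclic : Rel → Set
  Acyclic E = ∀ C → ¬ IsCycle E C

  Off : List (Fin n) → VSet
  Off P x = ¬ (x LM.∈ P)

  TwoConnected : Graph n → Set
  TwoConnected G =
    3 ≤ n × Connected (Adj G) AllV × (∀ w → Connected (Adj G) (λ x → x ≢ w))

  TwoVertexCut : Graph n → Fin n → Fin n → Set
  TwoVertexCut G u v =
    u ≢ v × ¬ Connected (Adj G) (λ x → x ≢ u × x ≢ v)

  Nonseparating : Graph n → List (Fin n) → Set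
  Nonseparating G P = Connected (Adj G) (Off P)

  record SpanningTree (G : Graph n) : Set₁ where
    field
      TAdj    : Rel
      tsym    : ∀ x y → TAdj x y → TAdj y x
      tsub    : ∀ x y → TAdj x y → Adj G x y
      tconn   : Connected TAdj AllV
      tacyc   : Acyclic TAdj

  open SpanningTree public

  IsTutteTree : (G : Graph n) → SpanningTree G → Set
  IsTutteTree G T = ∀ P → IsPath (TAdj T) P → Nonseparating G P

  HasTutteTree : Graph n → Set₁
  HasTutteTree G = Σ (SpanningTree G) (IsTutteTree G)

  -- {u,v}-bridges.  A bridge is either the single edge uv (trivial bridge)
  -- or a component C of G - {u,v} together with all edges joining C to {u,v}.

  data BridgeRep : Set where
    trivialB : BridgeRep
    compB    : Subset n → BridgeRep

  IsComponent : Graph n → Fin n → Fin n → Subset n → Set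
  IsComponent G u v C =
    (∃[ x ] x ∈ C)
    × (∀ x → x ∈ C → x ≢ u × x ≢ v)
    × Connected (Adj G) (λ x → x ∈ C)
    × (∀ x y → x ∈ C → Adj G x y → y ≢ u → y ≢ v → y ∈ C)

  IsBridge : Graph n → Fin n → Fin n → BridgeRep → Set
  IsBridge G u v trivialB  = Adj G u v
  IsBridge G u v (compB C) = IsComponent G u v C

  BVert : Fin n → Fin n → BridgeRep → VSet
  BVert u v trivialB  x = x ≡ u ⊎ x ≡ v
  BVert u v (compB C) x = x ∈ C ⊎ x ≡ u ⊎ x ≡ v

  BAdj : Graph n → Fin n → Fin n → BridgeRep → Rel
  BAdj G u v trivialB  x y = (x ≡ u × y ≡ v) ⊎ (x ≡ v × y ≡ u)
  BAdj G u v (compB C) x y = Adj G x y × (x ∈ C ⊎ y ∈ C)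

  HamPath : Graph n → Fin n → Fin n → BridgeRep → Set
  HamPath G u v B = Σ (List (Fin n)) λ P →
    IsPath (BAdj G u v B) P
    × head P ≡ just u
    × last P ≡ just v
    × (∀ x → x LM.∈ P → BVert u v B x)
    × (∀ x → BVert u v B x → x LM.∈ P)

  ExactlyBridges : Graph n → Fin n → Fin n → ℕ → Set
  ExactlyBridges G u v k = Σ (List BridgeRep) λ bs →
    length bs ≡ k
    × UniqueP.Unique bs
    × All (IsBridge G u v) bs
    × (∀ b → IsBridge G u v b → b LM.∈ bs)

  Alt1 : Graph n → Fin n → Fin n → Set
  Alt1 G u v = ExactlyBridges G u v 2
    × (∃[ b ] IsBridge G u v b × HamPath G u v b)

  Alt2 : Graph n → Fin n → Fin n → Set
  Alt2 G u v = ExactlyBridges G u v 3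
    × IsBridge G u v trivialB
    × (∃[ b ] IsBridge G u v b × b ≢ trivialB × HamPath G u v b)

ExactlyOne : Set → Set → Set
ExactlyOne A B = (A ⊎ B) × ¬ (A × B)

module Submission where

-- The tree path P from u to v in a Tutte tree is nonseparating, so G − P is
-- connected.  Its interior Q is connected too, and every vertex of G − {u,v}
-- lies in exactly one of the two.  Hence Q is nonempty (otherwise
-- G − {u,v} = G − P), G − P is nonempty (otherwise G − {u,v} = Q), and no
-- edge joins them (it would connect G − {u,v}).  So G − {u,v} has exactly the
-- two components Q and G − P, P is a Hamiltonian uv-path of the Q-bridge, and
-- the edge uv is a third bridge exactly when it is present.

open import Defs hiding (sym)
open import Data.Nat using (ℕ)
open import Data.Fin using (Fin; _≟_)
open import Data.Fin.Properties using (any?)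
open import Data.Fin.Subset using (Subset; _⊆_) renaming (_∈_ to _∈ₛ_)
open import Data.Fin.Subset.Properties using (⊆-antisym)
open import Data.Bool using (true)
import Data.Bool as Bool
open import Data.Vec using (tabulate)
open import Data.Vec.Properties using (lookup∘tabulate; []=⇒lookup; lookup⇒[]=)
open import Data.List using (List; []; _∷_; _++_; [_]; last)
open import Data.List.Relation.Unary.Linked using (Linked; []; [-]; _∷_)
import Data.List.Relation.Unary.Linked as Linked
open import Data.List.Relation.Unary.All using (All; []; _∷_)
import Data.List.Relation.Unary.All as All
open import Data.List.Relation.Unary.Any using (here; there)
open import Data.List.Relation.Unary.AllPairs using ([]; _∷_)
import Data.List.Relation.Unary.AllPairs as AllPairs
open import Data.List.Relation.Unary.Unique.Propositional using (Unique)
open import Data.List.Membership.Propositional using (_∈_; _∉_)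
open import Data.List.Membership.Propositional.Properties using (∈-++⁻; ∈-++⁺ˡ; ∈-++⁺ʳ)
import Data.List.Membership.DecPropositional as DecMembership
open import Data.Maybe using (just)
open import Data.Product using (_×_; Σ; ∃; ∃-syntax; _,_; proj₁; proj₂)
open import Data.Sum using (_⊎_; inj₁; inj₂)
open import Data.Empty using (⊥; ⊥-elim)
open import Data.Unit using (tt)
open import Function using (id)
open import Relation.Binary.PropositionalEquality using (_≡_; _≢_; refl; sym; trans; subst)
open import Relation.Nullary using (¬_; Dec; yes; no; does)
open import Relation.Nullary.Decidable using (¬?; dec-true)
import Relation.Unary as U

module _ {n : ℕ} {P : Fin n → Set} (P? : U.Decidable P) where

  toSubset : Subset n
  toSubset = tabulate (λ x → does (P? x))

  ∈-toSubset⁺ : ∀ {x} → P x → x ∈ₛ toSubset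
  ∈-toSubset⁺ {x} px = lookup⇒[]= x toSubset (trans (lookup∘tabulate _ x) (dec-true (P? x) px))

  ∈-toSubset⁻ : ∀ {x} → x ∈ₛ toSubset → P x
  ∈-toSubset⁻ {x} x∈ = invert (P? x) (trans (sym (lookup∘tabulate _ x)) ([]=⇒lookup x∈))
    where
    invert : ∀ {A : Set} (a? : Dec A) → does a? ≡ true → A
    invert (yes a) _ = a

module _ {A : Set} where

  last-∷ʳ : (a b : A) (xs : List A) → last (a ∷ xs ++ [ b ]) ≡ just b
  last-∷ʳ a b []       = refl
  last-∷ʳ a b (c ∷ xs) = last-∷ʳ c b xs

  Unique-∷ʳ⇒∉ : ∀ (b : A) xs → Unique (xs ++ [ b ]) → b ∉ xs
  Unique-∷ʳ⇒∉ b (x ∷ xs) (x≢ ∷ _) (here refl) = All.lookup x≢ (∈-++⁺ʳ xs (here refl)) refl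
  Unique-∷ʳ⇒∉ b (x ∷ xs) (_ ∷ u)  (there b∈) = Unique-∷ʳ⇒∉ b xs u b∈

  Linked-++⁻ˡ : ∀ {R : A → A → Set} xs {ys} → Linked R (xs ++ ys) → Linked R xs
  Linked-++⁻ˡ []           _       = []
  Linked-++⁻ˡ (x ∷ [])     _       = [-]
  Linked-++⁻ˡ (x ∷ y ∷ xs) (r ∷ l) = r ∷ Linked-++⁻ˡ (y ∷ xs) l

  Linked-touching : ∀ {R : A → A → Set} (S : A → Set) a b xs → All S xs → xs ≢ [] →
    Linked R (a ∷ xs ++ [ b ]) → Linked (λ x y → R x y × (S x ⊎ S y)) (a ∷ xs ++ [ b ])
  Linked-touching S a b []           _           xs≢[] _              = ⊥-elim (xs≢[] refl)
  Linked-touching S a b (c ∷ [])     (sc ∷ [])   _     (r₁ ∷ r₂ ∷ [-]) = (r₁ , inj₂ sc) ∷ (r₂ , inj₁ sc) ∷ [-]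
  Linked-touching S a b (c ∷ d ∷ xs) (sc ∷ sxs) _      (r ∷ l)         =
    (r , inj₂ sc) ∷ Linked-touching S c b (d ∷ xs) sxs (λ ()) l

  ≢[]⇒∃∈ : ∀ {xs : List A} → xs ≢ [] → ∃[ x ] x ∈ xs
  ≢[]⇒∃∈ {[]}    xs≢[] = ⊥-elim (xs≢[] refl)
  ≢[]⇒∃∈ {x ∷ _} _     = x , here refl

  ∈-pair⁻ : ∀ {x a b : A} → x ∈ a ∷ b ∷ [] → x ≡ a ⊎ x ≡ b
  ∈-pair⁻ (here eq)         = inj₁ eq
  ∈-pair⁻ (there (here eq)) = inj₂ eq

  three-distinct-∉-pair : ∀ {a b p q r : A} → Unique (p ∷ q ∷ r ∷ []) →
    ¬ All (_∈ a ∷ b ∷ []) (p ∷ q ∷ r ∷ [])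
  three-distinct-∉-pair ((p≢q ∷ p≢r ∷ []) ∷ (q≢r ∷ []) ∷ _) (p∈ ∷ q∈ ∷ r∈ ∷ [])
    with ∈-pair⁻ p∈ | ∈-pair⁻ q∈ | ∈-pair⁻ r∈
  ... | inj₁ refl | inj₁ refl | _         = p≢q refl
  ... | inj₂ refl | inj₂ refl | _         = p≢q refl
  ... | inj₁ refl | _         | inj₁ refl = p≢r refl
  ... | inj₂ refl | _         | inj₂ refl = p≢r refl
  ... | _         | inj₁ refl | inj₁ refl = q≢r refl
  ... | _         | inj₂ refl | inj₂ refl = q≢r refl

mapʷ : ∀ {n} {E : Rel {n}} {S S′ : VSet {n}} → (∀ {x} → S x → S′ x) →
  ∀ {x y} → Walk E S x y → Walk E S′ x y
mapʷ f (stay s)     = stay (f s)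
mapʷ f (step s e w) = step (f s) e (mapʷ f w)

module _ {n : ℕ} {E : Rel {n}} {S : VSet {n}} where

  walk-source : ∀ {x y} → Walk E S x y → S x
  walk-source (stay s)     = s
  walk-source (step s _ _) = s

  _++ʷ_ : ∀ {x y z} → Walk E S x y → Walk E S y z → Walk E S x z
  stay _       ++ʷ w = w
  step s e w₁ ++ʷ w = step s e (w₁ ++ʷ w)

  reverseʷ : (∀ {x y} → E x y → E y x) → ∀ {x y} → Walk E S x y → Walk E S y x
  reverseʷ E-sym (stay s)     = stay s
  reverseʷ E-sym (step s e w) = reverseʷ E-sym w ++ʷ step (walk-source w) (E-sym e) (stay s)

  walk-closed : (C : VSet) → (∀ {a b} → C a → E a b → S b → C b) →
    ∀ {x y} → Walk E S x y → C x → C y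
  walk-closed C closed (stay _)     cx = cx
  walk-closed C closed (step s e w) cx = walk-closed C closed w (closed cx e (walk-source w))

module _ {n : ℕ} {E : Rel {n}} where

  linked-walk : ∀ {c cs a} → Linked E (c ∷ cs) → a ∈ c ∷ cs → Walk E (_∈ c ∷ cs) c a
  linked-walk l       (here refl) = stay (here refl)
  linked-walk [-]     (there ())
  linked-walk (e ∷ l) (there a∈) = step (here refl) e (mapʷ there (linked-walk l a∈))

  Linked⇒Connected : (∀ {x y} → E x y → E y x) → ∀ {xs} → Linked E xs → Connected E (_∈ xs)
  Linked⇒Connected E-sym {[]}    _ _ _ ()
  Linked⇒Connected E-sym {_ ∷ _} l a b a∈ b∈ =
    reverseʷ E-sym (linked-walk l a∈) ++ʷ linked-walk l b∈

module _ {n : ℕ} where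

  data PathBetween (E : Rel {n}) : Fin n → Fin n → List (Fin n) → Set where
    single : ∀ {x} → PathBetween E x x [ x ]
    cons   : ∀ {x y z L} → E x y → PathBetween E y z L → PathBetween E x z (x ∷ L)

  PathBetween⇒Linked : ∀ {E x z L} → PathBetween E x z L → Linked E L
  PathBetween⇒Linked single                  = [-]
  PathBetween⇒Linked (cons e single)         = e ∷ [-]
  PathBetween⇒Linked (cons e (cons e′ path)) = e ∷ PathBetween⇒Linked (cons e′ path)

  PathBetween-suffix : ∀ {E y z L w} → PathBetween E y z L → w ∈ L →
    Σ (List (Fin n)) λ L′ → PathBetween E w z L′ × (Unique L → Unique L′)
  PathBetween-suffix single        (here refl) = _ , single , id
  PathBetween-suffix (cons e path) (here refl) = _ , cons e path , id
  PathBetween-suffix (cons e path) (there w∈) with PathBetween-suffix path w∈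
  ... | L′ , path′ , unique′ = L′ , path′ , λ { (_ ∷ L!) → unique′ L! }

  -- Shortcutting at the first repeated vertex turns a walk into a path.
  Walk⇒PathBetween : ∀ {E S x z} → Walk E S x z →
    Σ (List (Fin n)) λ L → PathBetween E x z L × Unique L
  Walk⇒PathBetween (stay _) = _ , single , [] ∷ []
  Walk⇒PathBetween {x = x} (step _ e w) with Walk⇒PathBetween w
  ... | L , path , L! with DecMembership._∈?_ _≟_ x L
  ...   | yes x∈L = let (L′ , path′ , unique′) = PathBetween-suffix path x∈L in L′ , path′ , unique′ L!
  ...   | no  x∉L = x ∷ L , cons e path , All.tabulate (λ { y∈L refl → x∉L y∈L }) ∷ L!

  PathBetween-interior : ∀ {E x z L} → PathBetween E x z L → (x ≡ z × L ≡ [ x ]) ⊎ ∃[ Q ] L ≡ x ∷ Q ++ [ z ]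
  PathBetween-interior single = inj₁ (refl , refl)
  PathBetween-interior (cons e path) with PathBetween-interior path
  ... | inj₁ (refl , refl) = inj₂ ([] , refl)
  ... | inj₂ (Q , refl)    = inj₂ (_ ∷ Q , refl)

  SpanningTree-path : ∀ {G : Graph n} (T : SpanningTree G) {u v} → u ≢ v →
    ∃[ Q ] IsPath (TAdj T) (u ∷ Q ++ [ v ])
  SpanningTree-path T {u} {v} u≢v with Walk⇒PathBetween (tconn T u v tt tt)
  ... | L , path , L! with PathBetween-interior path
  ...   | inj₁ (u≡v , _)  = ⊥-elim (u≢v u≡v)
  ...   | inj₂ (Q , refl) = Q , L! , PathBetween⇒Linked path , λ ()

  Adj-sym : (G : Graph n) → ∀ {x y} → Adj G x y → Adj G y x
  Adj-sym G {x} {y} e = trans (Graph.sym G y x) e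

  IsComponent-⊆ : ∀ {G : Graph n} {u v C D} → IsComponent G u v C → IsComponent G u v D →
    ∀ {x} → x ∈ₛ C → x ∈ₛ D → C ⊆ D
  IsComponent-⊆ {D = D} (_ , C-inner , C-connected , _) (_ , _ , _ , D-closed) {x} x∈C x∈D {y} y∈C =
    walk-closed (_∈ₛ D) (λ {a} {b} a∈D e b∈C → D-closed a b a∈D e (proj₁ (C-inner b b∈C)) (proj₂ (C-inner b b∈C)))
      (C-connected x y x∈C y∈C) x∈D

  IsComponent-unique : ∀ {G : Graph n} {u v C D} → IsComponent G u v C → IsComponent G u v D →
    ∀ {x} → x ∈ₛ C → x ∈ₛ D → C ≡ D
  IsComponent-unique {G = G} C-comp D-comp x∈C x∈D =
    ⊆-antisym (IsComponent-⊆ {G = G} C-comp D-comp x∈C x∈D) (IsComponent-⊆ {G = G} D-comp C-comp x∈D x∈C)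

  compB-injective : ∀ {C D : Subset n} → compB C ≡ compB D → C ≡ D
  compB-injective refl = refl

module NonseparatingPathBridges {n : ℕ} (G : Graph n) (u v : Fin n)
  (disconnected : ¬ Connected (Adj G) (λ x → x ≢ u × x ≢ v))
  (Q : List (Fin n))
  (P! : Unique (u ∷ Q ++ [ v ]))
  (P-linked : Linked (Adj G) (u ∷ Q ++ [ v ]))
  (P-nonseparating : Nonseparating G (u ∷ Q ++ [ v ])) where

  open DecMembership (_≟_ {n}) using (_∈?_)

  P : List (Fin n)
  P = u ∷ Q ++ [ v ]

  OffUV : VSet
  OffUV x = x ≢ u × x ≢ v

  u∉Q : u ∉ Q
  u∉Q u∈Q = All.lookup (AllPairs.head P!) (∈-++⁺ˡ u∈Q) refl

  v∉Q : v ∉ Q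
  v∉Q = Unique-∷ʳ⇒∉ v Q (AllPairs.tail P!)

  ∈P⁻ : ∀ {x} → x ∈ P → x ≡ u ⊎ x ∈ Q ⊎ x ≡ v
  ∈P⁻ (here x≡u) = inj₁ x≡u
  ∈P⁻ (there x∈) with ∈-++⁻ Q x∈
  ... | inj₁ x∈Q         = inj₂ (inj₁ x∈Q)
  ... | inj₂ (here x≡v) = inj₂ (inj₂ x≡v)

  Q⊆P : ∀ {x} → x ∈ Q → x ∈ P
  Q⊆P x∈Q = there (∈-++⁺ˡ x∈Q)

  v∈P : v ∈ P
  v∈P = there (∈-++⁺ʳ Q (here refl))

  Q⊆OffUV : ∀ {x} → x ∈ Q → OffUV x
  Q⊆OffUV x∈Q = (λ { refl → u∉Q x∈Q }) , (λ { refl → v∉Q x∈Q })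

  ∉P⇒OffUV : ∀ {x} → x ∉ P → OffUV x
  ∉P⇒OffUV x∉P = (λ { refl → x∉P (here refl) }) , (λ { refl → x∉P v∈P })

  OffUV∩P⊆Q : ∀ {x} → OffUV x → x ∈ P → x ∈ Q
  OffUV∩P⊆Q (x≢u , x≢v) x∈P with ∈P⁻ x∈P
  ... | inj₁ x≡u         = ⊥-elim (x≢u x≡u)
  ... | inj₂ (inj₁ x∈Q) = x∈Q
  ... | inj₂ (inj₂ x≡v) = ⊥-elim (x≢v x≡v)

  Q-connected : Connected (Adj G) (_∈ Q)
  Q-connected = Linked⇒Connected (Adj-sym G) (Linked-++⁻ˡ Q (Linked.tail P-linked))

  Q≢[] : Q ≢ []
  Q≢[] refl = disconnected λ a b a∉ b∉ → mapʷ ∉P⇒OffUV (P-nonseparating a b (off a∉) (off b∉))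
    where
    off : ∀ {x} → OffUV x → x ∉ P
    off (x≢u , _)   (here x≡u)         = x≢u x≡u
    off (_ , x≢v)   (there (here x≡v)) = x≢v x≡v

  outside-nonempty : ∃[ x ] x ∉ P
  outside-nonempty with any? (λ x → ¬? (x ∈? P))
  ... | yes outside = outside
  ... | no  none    = ⊥-elim (disconnected λ a b a∉ b∉ →
                        mapʷ Q⊆OffUV (Q-connected a b (inside a∉) (inside b∉)))
    where
    inside : ∀ {x} → OffUV x → x ∈ Q
    inside {x} x∉ with x ∈? P
    ... | yes x∈P = OffUV∩P⊆Q x∉ x∈P
    ... | no  x∉P = ⊥-elim (none (x , x∉P))

  -- Every vertex of G − {u,v} reaches x inside Q or y inside G − P, so one
  -- edge xy would make G − {u,v} connected.
  Q-isolated : ∀ {x y} → x ∈ Q → y ∉ P → ¬ Adj G x y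
  Q-isolated {x} {y} x∈Q y∉P e = disconnected λ a b a∉ b∉ →
    to-y a a∉ ++ʷ reverseʷ (Adj-sym G) (to-y b b∉)
    where
    to-y : ∀ a → OffUV a → Walk (Adj G) OffUV a y
    to-y a a∉ with a ∈? P
    ... | yes a∈P = mapʷ Q⊆OffUV (Q-connected a x (OffUV∩P⊆Q a∉ a∈P) x∈Q)
                      ++ʷ step (Q⊆OffUV x∈Q) e (stay (∉P⇒OffUV y∉P))
    ... | no  a∉P = mapʷ ∉P⇒OffUV (P-nonseparating a y a∉P y∉P)

  Inside Outside : Subset n
  Inside  = toSubset (_∈? Q)
  Outside = toSubset (λ x → ¬? (x ∈? P))

  ∈Inside⁺ : ∀ {x} → x ∈ Q → x ∈ₛ Inside
  ∈Inside⁺ = ∈-toSubset⁺ (_∈? Q)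

  ∈Inside⁻ : ∀ {x} → x ∈ₛ Inside → x ∈ Q
  ∈Inside⁻ = ∈-toSubset⁻ (_∈? Q)

  ∈Outside⁺ : ∀ {x} → x ∉ P → x ∈ₛ Outside
  ∈Outside⁺ = ∈-toSubset⁺ (λ x → ¬? (x ∈? P))

  ∈Outside⁻ : ∀ {x} → x ∈ₛ Outside → x ∉ P
  ∈Outside⁻ = ∈-toSubset⁻ (λ x → ¬? (x ∈? P))

  Inside-component : IsComponent G u v Inside
  Inside-component =
      (proj₁ (≢[]⇒∃∈ Q≢[]) , ∈Inside⁺ (proj₂ (≢[]⇒∃∈ Q≢[])))
    , (λ x x∈ → Q⊆OffUV (∈Inside⁻ x∈))
    , (λ a b a∈ b∈ → mapʷ ∈Inside⁺ (Q-connected a b (∈Inside⁻ a∈) (∈Inside⁻ b∈)))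
    , closed
    where
    closed : ∀ x y → x ∈ₛ Inside → Adj G x y → y ≢ u → y ≢ v → y ∈ₛ Inside
    closed x y x∈ e y≢u y≢v with y ∈? P
    ... | yes y∈P = ∈Inside⁺ (OffUV∩P⊆Q (y≢u , y≢v) y∈P)
    ... | no  y∉P = ⊥-elim (Q-isolated (∈Inside⁻ x∈) y∉P e)

  Outside-component : IsComponent G u v Outside
  Outside-component =
      (proj₁ outside-nonempty , ∈Outside⁺ (proj₂ outside-nonempty))
    , (λ x x∈ → ∉P⇒OffUV (∈Outside⁻ x∈))
    , (λ a b a∈ b∈ → mapʷ ∈Outside⁺ (P-nonseparating a b (∈Outside⁻ a∈) (∈Outside⁻ b∈)))
    , closed
    where
    closed : ∀ x y → x ∈ₛ Outside → Adj G x y → y ≢ u → y ≢ v → y ∈ₛ Outside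
    closed x y x∈ e y≢u y≢v with y ∈? P
    ... | yes y∈P = ⊥-elim (Q-isolated (OffUV∩P⊆Q (y≢u , y≢v) y∈P) (∈Outside⁻ x∈) (Adj-sym G e))
    ... | no  y∉P = ∈Outside⁺ y∉P

  Inside≢Outside : compB Inside ≢ compB Outside
  Inside≢Outside eq = x∉P (Q⊆P (∈Inside⁻ (subst (x ∈ₛ_) (sym (compB-injective eq)) (∈Outside⁺ x∉P))))
    where
    x = proj₁ outside-nonempty
    x∉P = proj₂ outside-nonempty

  component-cases : ∀ {C} → IsComponent G u v C → C ≡ Inside ⊎ C ≡ Outside
  component-cases C-comp@((x , x∈C) , C-inner , _) with x ∈? P
  ... | yes x∈P = inj₁ (IsComponent-unique {G = G} C-comp Inside-component x∈C
                    (∈Inside⁺ (OffUV∩P⊆Q (C-inner x x∈C) x∈P)))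
  ... | no  x∉P = inj₂ (IsComponent-unique {G = G} C-comp Outside-component x∈C (∈Outside⁺ x∉P))

  Inside-hamiltonian : HamPath G u v (compB Inside)
  Inside-hamiltonian =
      P
    , (P! , Linked-touching (_∈ₛ Inside) u v Q (All.tabulate ∈Inside⁺) Q≢[] P-linked , λ ())
    , refl
    , last-∷ʳ u v Q
    , (λ x x∈P → in-bridge (∈P⁻ x∈P))
    , (λ x → in-P)
    where
    in-bridge : ∀ {x} → x ≡ u ⊎ x ∈ Q ⊎ x ≡ v → x ∈ₛ Inside ⊎ x ≡ u ⊎ x ≡ v
    in-bridge (inj₁ x≡u)         = inj₂ (inj₁ x≡u)
    in-bridge (inj₂ (inj₁ x∈Q)) = inj₁ (∈Inside⁺ x∈Q)
    in-bridge (inj₂ (inj₂ x≡v)) = inj₂ (inj₂ x≡v)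
    in-P : ∀ {x} → x ∈ₛ Inside ⊎ x ≡ u ⊎ x ≡ v → x ∈ P
    in-P (inj₁ x∈)          = Q⊆P (∈Inside⁻ x∈)
    in-P (inj₂ (inj₁ refl)) = here refl
    in-P (inj₂ (inj₂ refl)) = v∈P

  components : List BridgeRep
  components = compB Inside ∷ compB Outside ∷ []

  components! : Unique components
  components! = (Inside≢Outside ∷ []) ∷ [] ∷ []

  components-bridges : All (IsBridge G u v) components
  components-bridges = Inside-component ∷ Outside-component ∷ []

  component∈components : ∀ {C} → IsComponent G u v C → compB C ∈ components
  component∈components C-comp with component-cases C-comp
  ... | inj₁ refl = here refl
  ... | inj₂ refl = there (here refl)

  alternatives : Alt1 G u v ⊎ Alt2 G u v
  alternatives with adj G u v Bool.≟ true
  ... | no ¬uv = inj₁ ((components , refl , components! , components-bridges , complete)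
                     , compB Inside , Inside-component , Inside-hamiltonian)
    where
    complete : ∀ b → IsBridge G u v b → b ∈ components
    complete trivialB  uv     = ⊥-elim (¬uv uv)
    complete (compB C) C-comp = component∈components C-comp
  ... | yes uv = inj₂ ((trivialB ∷ components , refl
                     , ((λ ()) ∷ (λ ()) ∷ []) ∷ components!
                     , uv ∷ components-bridges , complete)
                     , uv , compB Inside , Inside-component , (λ ()) , Inside-hamiltonian)
    where
    complete : ∀ b → IsBridge G u v b → b ∈ trivialB ∷ components
    complete trivialB  _      = here refl
    complete (compB C) C-comp = there (component∈components C-comp)

module _ {n : ℕ} {G : Graph n} {u v : Fin n} where

  ExactlyBridges-2≢3 : ExactlyBridges G u v 2 → ¬ ExactlyBridges G u v 3
  ExactlyBridges-2≢3 (_ ∷ _ ∷ [] , refl , _ , _ , complete) (_ ∷ _ ∷ _ ∷ [] , refl , distinct , bridges , _) =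
    three-distinct-∉-pair distinct (All.map (complete _) bridges)

  Alt1-Alt2-exclusive : ¬ (Alt1 G u v × Alt2 G u v)
  Alt1-Alt2-exclusive ((two , _) , (three , _)) = ExactlyBridges-2≢3 two three

lemma3 : ∀ {n : ℕ} (G : Graph n) (u v : Fin n) →
    TwoConnected G → TwoVertexCut G u v → HasTutteTree G →
    ExactlyOne (Alt1 G u v) (Alt2 G u v)
lemma3 G u v _ (u≢v , disconnected) (T , tutte) =
  let Q , path@(P! , P-tree-linked , _) = SpanningTree-path T u≢v
  in NonseparatingPathBridges.alternatives G u v disconnected Q P!
       (Linked.map (tsub T _ _) P-tree-linked) (tutte _ path)
   , Alt1-Alt2-exclusive
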